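{- Let $M$ be a matroid with lattice of flats $\mathcal{L}$. For any two flats $F_1\subseteq F_2$ of $M$, \[[\rk(F_2)-\rk(F_1)]_q=\sum_{\substack{F\in\mathcal{L}\\ F_1\subseteq F\subsetneq F_2}}\overline{\chi}_{M|F_2/F}(q).\]
   Context: $M$ is a matroid on finite non-empty ground set $E$ with rank function $\rk$; $M|F_2/F$ denotes the minor obtained by restricting to $F_2$ and contracting $F$. $\chi_N(q)=\sum_{S}(-1)^{\#S}q^{\rk N-\rk S}$ (sum over subsets of the ground set of $N$), $\overline{\chi}_N(q)=\chi_N(q)/(q-1)$, and $[n]_q=1+q+\cdots+q^{n-1}=(q^n-1)/(q-1)$. -}

module Defs where

open import Data.Nat using (ℕ; zero; suc; _≤_; _<ᵇ_; _∸_) renaming (_+_ to _+ℕ_)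
open import Data.Bool using (Bool; true; false; if_then_else_; _∧_; _∨_; T)
open import Data.List using (List; []; _∷_; map; _++_; foldr; allFin)
open import Data.Bool.ListAction using (all)
open import Data.Fin using (Fin)
open import Data.Fin.Subset using (Subset; _∈_; _∉_; _⊆_; _⊂_; _∪_; _∩_; _─_; ⁅_⁆; ∣_∣; outside; inside)
open import Data.Fin.Subset.Properties using (_∈?_; _⊆?_; _⊂?_)
open import Data.Vec using (Vec; []; _∷_)
open import Data.Rational using (ℚ; 0ℚ; 1ℚ; _+_; _*_; _-_; -_; _÷_; NonZero)
open import Relation.Nullary using (Dec; does)

record Matroid (n : ℕ) : Set where
  field
    rk        : Subset n → ℕ
    rk-card   : ∀ S → rk S ≤ ∣ S ∣
    rk-mono   : ∀ {S T} → S ⊆ T → rk S ≤ rk T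
    rk-submod : ∀ S T → rk (S ∪ T) +ℕ rk (S ∩ T) ≤ rk S +ℕ rk T
open Matroid public

allSubsets : (n : ℕ) → List (Subset n)
allSubsets zero    = [] ∷ []
allSubsets (suc n) = map (outside ∷_) (allSubsets n) ++ map (inside ∷_) (allSubsets n)

IsFlat : ∀ {n} → Matroid n → Subset n → Set
IsFlat {n} M F = ∀ (e : Fin n) → e ∉ F → rk M F Data.Nat.< rk M (F ∪ ⁅ e ⁆)

isFlatᵇ : ∀ {n} → Matroid n → Subset n → Bool
isFlatᵇ {n} M F = all (λ e → does (e ∈? F) ∨ (rk M F <ᵇ rk M (F ∪ ⁅ e ⁆))) (allFin n)

_^_ : ℚ → ℕ → ℚ
q ^ zero  = 1ℚ
q ^ suc k = q * (q ^ k)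

sumWhere : ∀ {A : Set} → (A → Bool) → (A → ℚ) → List A → ℚ
sumWhere p f = foldr (λ x acc → (if p x then f x else 0ℚ) + acc) 0ℚ

qInt : ℕ → ℚ → ℚ
qInt zero    q = 0ℚ
qInt (suc k) q = qInt k q + q ^ k

-- Characteristic polynomial (evaluated at q) of a matroid N whose ground set is
-- G ⊆ Fin n and whose rank function is ρ (only its values on subsets of G matter):
--   χ_N(q) = Σ_{S ⊆ G} (-1)^{#S} q^{ρ G - ρ S}.
χ : ∀ {n} → Subset n → (Subset n → ℕ) → ℚ → ℚ
χ {n} G ρ q = sumWhere (λ S → does (S ⊆? G)) (λ S → ((- 1ℚ) ^ ∣ S ∣) * (q ^ (ρ G ∸ ρ S))) (allSubsets n)

-- The minor M|F₂/F : ground set F₂ ∖ F, rank S ↦ rk(S ∪ F) − rk(F).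
minorGround : ∀ {n} → Subset n → Subset n → Subset n
minorGround F F₂ = F₂ ─ F

minorRank : ∀ {n} → Matroid n → Subset n → Subset n → ℕ
minorRank M F S = rk M (S ∪ F) ∸ rk M F

χMinor : ∀ {n} → Matroid n → Subset n → Subset n → ℚ → ℚ
χMinor M F F₂ q = χ (minorGround F F₂) (minorRank M F) q

χ̄Minor : ∀ {n} → Matroid n → Subset n → Subset n → (q : ℚ) → .{{NonZero (q - 1ℚ)}} → ℚ
χ̄Minor M F F₂ q = χMinor M F F₂ q ÷ (q - 1ℚ)

sumFlatsBetween : ∀ {n} → Matroid n → Subset n → Subset n → (q : ℚ) → .{{NonZero (q - 1ℚ)}} → ℚ
sumFlatsBetween {n} M F₁ F₂ q =
  sumWhere (λ F → isFlatᵇ M F ∧ does (F₁ ⊆? F) ∧ does (F ⊂? F₂))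
           (λ F → χ̄Minor M F F₂ q)
           (allSubsets n)

-- Adding the term F = F₂ (where χ = 1) and multiplying by q − 1, the claim becomes
-- Σ χ_{M|F₂/F}(q) = q^{rk F₂ − rk F₁} over all flats F₁ ⊆ F ⊆ F₂.  Reindexing the defining
-- sum of χ_{M|F₂/F} by S ↦ S ∪ F and grouping the sets S by their closure H gives
-- χ_{M|F₂/F}(q) = Σ_H μ(F,H) q^{rk F₂ − rk H} over flats F ⊆ H ⊆ F₂, where
-- μ(F,H) = Σ (−1)^{|S∖F|} over F ⊆ S ⊆ H with rk S = rk H.  Grouping the alternating sum
-- over an interval of subsets in the same way shows that μ inverts the zeta function of the
-- lattice of flats from one side, hence from both; exchanging the two sums then leaves
-- only the term H = F₁.

module Submission where

open import Defs
open import Data.Nat using (ℕ; zero; suc; _∸_; _≤_; _<ᵇ_) renaming (_+_ to _+ℕ_)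
import Data.Nat.Properties as ℕ
open import Data.Rational using (ℚ; 0ℚ; 1ℚ; _+_; _*_; _-_; -_; 1/_; NonZero)
import Data.Rational.Properties as ℚ
open import Data.Bool using (Bool; true; false; if_then_else_; _∧_; _∨_; T; _≟_)
open import Data.Bool.Properties using (T-∧)
open import Data.Product using (∃-syntax; _×_; _,_; proj₁; proj₂)
open import Data.Sum using ([_,_]′)
open import Data.Empty using (⊥-elim)
open import Data.List using (List; []; _∷_; map; _++_; allFin)
open import Data.List.Membership.Propositional.Properties using (∈-allFin)
open import Data.List.Relation.Unary.All as All using ()
open import Data.List.Relation.Unary.All.Properties using (all⁺; all⁻)
open import Data.Vec using ([]; _∷_)
open import Data.Vec.Properties using (≡-dec)
open import Data.Fin using (Fin)
open import Data.Fin.Properties using (any?)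
open import Data.Fin.Subset using (Subset; outside; inside; _∈_; _⊆_; _⊂_; _⊃_; _─_; _∪_; _∩_; ⁅_⁆; ∣_∣)
open import Data.Fin.Subset.Properties
  using (_∈?_; _⊆?_; _⊂?_; p⊆p∪q; q⊆p∪q; x∈p∪q⁻; x∈p∩q⁺; x∈⁅x⁆; x∈⁅y⁆⇒x≡y; ⊆-trans; ⊆-antisym)
open import Data.Fin.Subset.Induction using (⊂-wellFounded; ⊃-wellFounded)
open import Induction.WellFounded using (Acc; acc)
open import Function using (_∘_; id)
open import Function.Bundles using (Equivalence)
open import Relation.Nullary using (Dec; ¬_; yes; no; does; contradiction; dec⇒maybe)
open import Relation.Nullary.Decidable using (does-≡; map′; ¬?; _×-dec_)
open import Relation.Binary.Definitions using (DecidableEquality)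
open import Relation.Binary.PropositionalEquality
  using (_≡_; refl; sym; trans; cong; cong₂; subst; module ≡-Reasoning)
open import Algebra.Properties.Group ℚ.+-0-group using (∙-cancelˡ)
open import Tactic.RingSolver using (solve-∀)
open import Tactic.RingSolver.Core.AlmostCommutativeRing using (AlmostCommutativeRing; fromCommutativeRing)

ℚ-ring : AlmostCommutativeRing _ _
ℚ-ring = fromCommutativeRing ℚ.+-*-commutativeRing (λ x → dec⇒maybe (0ℚ ℚ.≟ x))

when : Bool → ℚ → ℚ
when b x = if b then x else 0ℚ

when-∧ : ∀ a b x → when (a ∧ b) x ≡ when a (when b x)
when-∧ true  b x = refl
when-∧ false b x = refl

when-comm : ∀ a b x → when a (when b x) ≡ when b (when a x)
when-comm true  true  x = refl
when-comm true  false x = refl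
when-comm false true  x = refl
when-comm false false x = refl

when-0 : ∀ b → when b 0ℚ ≡ 0ℚ
when-0 true  = refl
when-0 false = refl

when-+ : ∀ b x y → when b (x + y) ≡ when b x + when b y
when-+ true  x y = refl
when-+ false x y = sym (ℚ.+-identityˡ 0ℚ)

when-*ˡ : ∀ b c x → c * when b x ≡ when b (c * x)
when-*ˡ true  c x = refl
when-*ˡ false c x = ℚ.*-zeroʳ c

when-*ʳ : ∀ b x c → when b x * c ≡ when b (x * c)
when-*ʳ true  x c = refl
when-*ʳ false x c = ℚ.*-zeroˡ c

when-cong : ∀ b {x y} → (T b → x ≡ y) → when b x ≡ when b y
when-cong true  x≡y = x≡y _
when-cong false x≡y = refl

when-T : ∀ {b} x → T b → when b x ≡ x
when-T {true} x _ = refl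

when-¬T : ∀ {b} x → ¬ T b → when b x ≡ 0ℚ
when-¬T {true}  x ¬b = contradiction _ ¬b
when-¬T {false} x ¬b = refl

when-∧-split : ∀ a {b b₁ b₂} → (∀ x → when b x ≡ when b₁ x + when b₂ x) →
  ∀ x → when (a ∧ b) x ≡ when (a ∧ b₁) x + when (a ∧ b₂) x
when-∧-split true  split x = split x
when-∧-split false split x = sym (ℚ.+-identityˡ 0ℚ)

when-rotate : ∀ a b c x → when a (when b (when c x)) ≡ when c (when a (when b x))
when-rotate a b c x = trans (cong (when a) (when-comm b c x)) (when-comm a c (when b x))

sumWhere-++ : ∀ {A : Set} (p : A → Bool) (f : A → ℚ) xs ys →
  sumWhere p f (xs ++ ys) ≡ sumWhere p f xs + sumWhere p f ys
sumWhere-++ p f []       ys = sym (ℚ.+-identityˡ _)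
sumWhere-++ p f (x ∷ xs) ys =
  trans (cong (when (p x) (f x) +_) (sumWhere-++ p f xs ys))
        (sym (ℚ.+-assoc (when (p x) (f x)) (sumWhere p f xs) (sumWhere p f ys)))

sumWhere-map : ∀ {A B : Set} (p : B → Bool) (f : B → ℚ) (g : A → B) xs →
  sumWhere p f (map g xs) ≡ sumWhere (λ x → p (g x)) (λ x → f (g x)) xs
sumWhere-map p f g []       = refl
sumWhere-map p f g (x ∷ xs) = cong (when (p (g x)) (f (g x)) +_) (sumWhere-map p f g xs)

-- Opaque so that ∑ f stays rigid and unification can read f off it.
opaque
  ∑ : ∀ {N} → (Subset N → ℚ) → ℚ
  ∑ {zero}  f = f []
  ∑ {suc N} f = ∑ (λ S → f (outside ∷ S)) + ∑ (λ S → f (inside ∷ S))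

opaque
  unfolding ∑

  ∑-cong : ∀ {N} {f g : Subset N → ℚ} → (∀ S → f S ≡ g S) → ∑ f ≡ ∑ g
  ∑-cong {zero}  e = e []
  ∑-cong {suc N} e = cong₂ _+_ (∑-cong (λ S → e (outside ∷ S))) (∑-cong (λ S → e (inside ∷ S)))

  ∑-0 : ∀ {N} → ∑ {N} (λ _ → 0ℚ) ≡ 0ℚ
  ∑-0 {zero}  = refl
  ∑-0 {suc N} = trans (cong₂ _+_ (∑-0 {N}) (∑-0 {N})) (ℚ.+-identityˡ 0ℚ)

  ∑-+ : ∀ {N} (f g : Subset N → ℚ) → ∑ (λ S → f S + g S) ≡ ∑ f + ∑ g
  ∑-+ {zero}  f g = refl
  ∑-+ {suc N} f g =
    trans (cong₂ _+_ (∑-+ (λ S → f (outside ∷ S)) (λ S → g (outside ∷ S)))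
                     (∑-+ (λ S → f (inside ∷ S)) (λ S → g (inside ∷ S))))
          (+-interchange (∑ (λ S → f (outside ∷ S))) (∑ (λ S → g (outside ∷ S)))
                         (∑ (λ S → f (inside ∷ S))) (∑ (λ S → g (inside ∷ S))))
    where
    +-interchange : ∀ a b c d → (a + b) + (c + d) ≡ (a + c) + (b + d)
    +-interchange = solve-∀ ℚ-ring

  ∑-*ˡ : ∀ {N} c (f : Subset N → ℚ) → ∑ (λ S → c * f S) ≡ c * ∑ f
  ∑-*ˡ {zero}  c f = refl
  ∑-*ˡ {suc N} c f = trans (cong₂ _+_ (∑-*ˡ c (λ S → f (outside ∷ S))) (∑-*ˡ c (λ S → f (inside ∷ S))))
    (sym (ℚ.*-distribˡ-+ c (∑ (λ S → f (outside ∷ S))) (∑ (λ S → f (inside ∷ S)))))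

  ∑-*ʳ : ∀ {N} c (f : Subset N → ℚ) → ∑ (λ S → f S * c) ≡ ∑ f * c
  ∑-*ʳ {zero}  c f = refl
  ∑-*ʳ {suc N} c f = trans (cong₂ _+_ (∑-*ʳ c (λ S → f (outside ∷ S))) (∑-*ʳ c (λ S → f (inside ∷ S))))
    (sym (ℚ.*-distribʳ-+ c (∑ (λ S → f (outside ∷ S))) (∑ (λ S → f (inside ∷ S)))))

  ∑-swap : ∀ {M N} (f : Subset M → Subset N → ℚ) →
    ∑ (λ S → ∑ (λ T → f S T)) ≡ ∑ (λ T → ∑ (λ S → f S T))
  ∑-swap {zero}  f = refl
  ∑-swap {suc M} f = trans (cong₂ _+_ (∑-swap (λ S → f (outside ∷ S))) (∑-swap (λ S → f (inside ∷ S))))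
    (sym (∑-+ (λ T → ∑ (λ S → f (outside ∷ S) T)) (λ T → ∑ (λ S → f (inside ∷ S) T))))

  sumWhere-allSubsets : ∀ {N} (p : Subset N → Bool) (f : Subset N → ℚ) →
    sumWhere p f (allSubsets N) ≡ ∑ (λ S → when (p S) (f S))
  sumWhere-allSubsets {zero}  p f = ℚ.+-identityʳ _
  sumWhere-allSubsets {suc N} p f = begin
    sumWhere p f (map (outside ∷_) Ss ++ map (inside ∷_) Ss)
      ≡⟨ sumWhere-++ p f (map (outside ∷_) Ss) (map (inside ∷_) Ss) ⟩
    sumWhere p f (map (outside ∷_) Ss) + sumWhere p f (map (inside ∷_) Ss)
      ≡⟨ cong₂ _+_ (sumWhere-map p f (outside ∷_) Ss) (sumWhere-map p f (inside ∷_) Ss) ⟩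
    sumWhere (λ S → p (outside ∷ S)) (λ S → f (outside ∷ S)) Ss
      + sumWhere (λ S → p (inside ∷ S)) (λ S → f (inside ∷ S)) Ss
      ≡⟨ cong₂ _+_ (sumWhere-allSubsets (λ S → p (outside ∷ S)) (λ S → f (outside ∷ S)))
                   (sumWhere-allSubsets (λ S → p (inside ∷ S)) (λ S → f (inside ∷ S))) ⟩
    ∑ (λ S → when (p S) (f S)) ∎
    where
    open ≡-Reasoning
    Ss : List (Subset N)
    Ss = allSubsets N

  ∑-split : ∀ {N} (f : Subset (suc N) → ℚ) → ∑ f ≡ ∑ (λ S → f (outside ∷ S)) + ∑ (λ S → f (inside ∷ S))
  ∑-split f = refl

  ∑-[] : (f : Subset zero → ℚ) → ∑ f ≡ f []
  ∑-[] f = refl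

when-∑ : ∀ {N} b (f : Subset N → ℚ) → when b (∑ f) ≡ ∑ (λ S → when b (f S))
when-∑ true  f = refl
when-∑ false f = sym ∑-0

∑-when-0 : ∀ {N} (p : Subset N → Bool) → ∑ (λ S → when (p S) 0ℚ) ≡ 0ℚ
∑-when-0 p = trans (∑-cong (λ S → when-0 (p S))) ∑-0

∑-when-swap : ∀ {M N} (a : Subset M → Bool) (b : Subset N → Bool) (f : Subset M → Subset N → ℚ) →
  ∑ (λ F → when (a F) (∑ (λ H → when (b H) (f F H)))) ≡ ∑ (λ H → when (b H) (∑ (λ F → when (a F) (f F H))))
∑-when-swap a b f =
  trans (∑-cong (λ F → when-∑ (a F) _))
 (trans (∑-swap _)
        (∑-cong (λ H → trans (∑-cong (λ F → when-comm (a F) (b H) _)) (sym (when-∑ (b H) _)))))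

from-does : ∀ {P : Set} (d : Dec P) → T (does d) → P
from-does (yes p) _ = p

to-does : ∀ {P : Set} (d : Dec P) → P → T (does d)
to-does (yes _) _ = _
to-does (no ¬p) p = contradiction p ¬p

T-∧⁻ : ∀ {a b} → T (a ∧ b) → T a × T b
T-∧⁻ = Equivalence.to T-∧

T-∧⁺ : ∀ {a b} → T a → T b → T (a ∧ b)
T-∧⁺ a b = Equivalence.from T-∧ (a , b)

infix 4 _⊆ᵇ_ _⊂ᵇ_ _≟ˢ_ _≡ᵇ_

_≟ˢ_ : ∀ {N} → DecidableEquality (Subset N)
_≟ˢ_ = ≡-dec _≟_

_⊆ᵇ_ _⊂ᵇ_ _≡ᵇ_ : ∀ {N} → Subset N → Subset N → Bool
p ⊆ᵇ q = does (p ⊆? q)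
p ⊂ᵇ q = does (p ⊂? q)
p ≡ᵇ q = does (p ≟ˢ q)

≡ᵇ-sym : ∀ {N} (p q : Subset N) → (p ≡ᵇ q) ≡ (q ≡ᵇ p)
≡ᵇ-sym p q = does-≡ (p ≟ˢ q) (map′ sym sym (q ≟ˢ p))

when-⊆ᵇ-split : ∀ {N} (p q : Subset N) x → when (p ⊆ᵇ q) x ≡ when (p ⊂ᵇ q) x + when (p ≡ᵇ q) x
when-⊆ᵇ-split []            []            x = sym (ℚ.+-identityˡ x)
when-⊆ᵇ-split (outside ∷ p) (outside ∷ q) x = when-⊆ᵇ-split p q x
when-⊆ᵇ-split (outside ∷ p) (inside  ∷ q) x = sym (ℚ.+-identityʳ _)
when-⊆ᵇ-split (inside  ∷ p) (outside ∷ q) x = sym (ℚ.+-identityˡ 0ℚ)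
when-⊆ᵇ-split (inside  ∷ p) (inside  ∷ q) x = when-⊆ᵇ-split p q x

∑-[≡] : ∀ {N} (A : Subset N) (f : Subset N → ℚ) → ∑ (λ S → when (S ≡ᵇ A) (f S)) ≡ f A
∑-[≡] []            f = ∑-[] _
∑-[≡] (outside ∷ A) f = begin
  ∑ (λ S → when (S ≡ᵇ outside ∷ A) (f S))                      ≡⟨ ∑-split _ ⟩
  ∑ (λ S → when (S ≡ᵇ A) (f (outside ∷ S))) + ∑ (λ _ → 0ℚ)     ≡⟨ cong₂ _+_ (∑-[≡] A _) ∑-0 ⟩
  f (outside ∷ A) + 0ℚ                                          ≡⟨ ℚ.+-identityʳ _ ⟩
  f (outside ∷ A)                                               ∎
  where open ≡-Reasoning
∑-[≡] (inside ∷ A) f = begin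
  ∑ (λ S → when (S ≡ᵇ inside ∷ A) (f S))                       ≡⟨ ∑-split _ ⟩
  ∑ (λ _ → 0ℚ) + ∑ (λ S → when (S ≡ᵇ A) (f (inside ∷ S)))      ≡⟨ cong₂ _+_ ∑-0 (∑-[≡] A _) ⟩
  0ℚ + f (inside ∷ A)                                           ≡⟨ ℚ.+-identityˡ _ ⟩
  f (inside ∷ A)                                                ∎
  where open ≡-Reasoning

∑-point : ∀ {N} (p : Subset N → Bool) (A : Subset N) (f : Subset N → ℚ) →
  (∀ S → T (p S) → S ≡ A) → T (p A) → ∑ (λ S → when (p S) (f S)) ≡ f A
∑-point p A f only-A pA = trans (∑-cong at) (∑-[≡] A f)
  where
  at : ∀ S → when (p S) (f S) ≡ when (S ≡ᵇ A) (f S)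
  at S with S ≟ˢ A
  ... | yes refl = when-T (f A) pA
  ... | no S≢A   = when-¬T (f S) (S≢A ∘ only-A S)

─-∪-cancel : ∀ {N} (p q : Subset N) → T (q ⊆ᵇ p) → (p ─ q) ∪ q ≡ p
─-∪-cancel []            []            _   = refl
─-∪-cancel (outside ∷ p) (outside ∷ q) q⊆p = cong (outside ∷_) (─-∪-cancel p q q⊆p)
─-∪-cancel (inside  ∷ p) (outside ∷ q) q⊆p = cong (inside ∷_) (─-∪-cancel p q q⊆p)
─-∪-cancel (inside  ∷ p) (inside  ∷ q) q⊆p = cong (inside ∷_) (─-∪-cancel p q q⊆p)

∑-⊆─-reindex : ∀ {N} (F B : Subset N) → T (F ⊆ᵇ B) → (g : Subset N → ℚ) →
  ∑ (λ S → when (S ⊆ᵇ B ─ F) (g S)) ≡ ∑ (λ U → when (U ⊆ᵇ B) (when (F ⊆ᵇ U) (g (U ─ F))))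
∑-⊆─-reindex []            []            _   g = trans (∑-[] _) (sym (∑-[] _))
∑-⊆─-reindex (outside ∷ F) (outside ∷ B) F⊆B g =
  trans (∑-split _) (trans (cong (_+ ∑ (λ _ → 0ℚ)) (∑-⊆─-reindex F B F⊆B _)) (sym (∑-split _)))
∑-⊆─-reindex (outside ∷ F) (inside ∷ B)  F⊆B g =
  trans (∑-split _) (trans (cong₂ _+_ (∑-⊆─-reindex F B F⊆B _) (∑-⊆─-reindex F B F⊆B _)) (sym (∑-split _)))
∑-⊆─-reindex (inside ∷ F)  (inside ∷ B)  F⊆B g = begin
  ∑ (λ S → when (S ⊆ᵇ (inside ∷ B) ─ (inside ∷ F)) (g S))
    ≡⟨ ∑-split _ ⟩
  ∑ (λ S → when (S ⊆ᵇ B ─ F) (g (outside ∷ S))) + ∑ (λ _ → 0ℚ)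
    ≡⟨ cong₂ _+_ (∑-⊆─-reindex F B F⊆B _) ∑-0 ⟩
  ∑ term + 0ℚ
    ≡⟨ ℚ.+-comm (∑ term) 0ℚ ⟩
  0ℚ + ∑ term
    ≡⟨ cong (_+ ∑ term) (sym (∑-when-0 (_⊆ᵇ B))) ⟩
  ∑ (λ U → when (U ⊆ᵇ B) 0ℚ) + ∑ term
    ≡⟨ sym (∑-split _) ⟩
  ∑ (λ U → when (U ⊆ᵇ inside ∷ B) (when (inside ∷ F ⊆ᵇ U) (g (U ─ (inside ∷ F))))) ∎
  where
  open ≡-Reasoning
  term : Subset _ → ℚ
  term U = when (U ⊆ᵇ B) (when (F ⊆ᵇ U) (g (outside ∷ (U ─ F))))

sign : ∀ {N} → Subset N → ℚ
sign S = (- 1ℚ) ^ ∣ S ∣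

sign-─-self : ∀ {N} (p : Subset N) → sign (p ─ p) ≡ 1ℚ
sign-─-self []            = refl
sign-─-self (outside ∷ p) = sign-─-self p
sign-─-self (inside ∷ p)  = sign-─-self p

∑-alternating : ∀ {N} (F B : Subset N) →
  ∑ (λ U → when (U ⊆ᵇ B) (when (F ⊆ᵇ U) (sign (U ─ F)))) ≡ when (F ≡ᵇ B) 1ℚ
∑-alternating []            []            = ∑-[] _
∑-alternating (outside ∷ F) (outside ∷ B) =
  trans (∑-split _) (trans (cong₂ _+_ (∑-alternating F B) ∑-0) (ℚ.+-identityʳ _))
∑-alternating (outside ∷ F) (inside ∷ B)  = begin
  ∑ (λ U → when (U ⊆ᵇ inside ∷ B) (when (outside ∷ F ⊆ᵇ U) (sign (U ─ (outside ∷ F)))))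
    ≡⟨ ∑-split _ ⟩
  ∑ term + ∑ (λ U → when (U ⊆ᵇ B) (when (F ⊆ᵇ U) (- 1ℚ * sign (U ─ F))))
    ≡⟨ cong (∑ term +_) (∑-cong λ U → sym (trans (when-*ˡ (U ⊆ᵇ B) (- 1ℚ) _)
                                                  (cong (when (U ⊆ᵇ B)) (when-*ˡ (F ⊆ᵇ U) (- 1ℚ) _)))) ⟩
  ∑ term + ∑ (λ U → - 1ℚ * term U)
    ≡⟨ cong (∑ term +_) (∑-*ˡ (- 1ℚ) term) ⟩
  ∑ term + - 1ℚ * ∑ term
    ≡⟨ x-x≡0 (∑ term) ⟩
  0ℚ ∎
  where
  open ≡-Reasoning
  term : Subset _ → ℚ
  term U = when (U ⊆ᵇ B) (when (F ⊆ᵇ U) (sign (U ─ F)))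
  x-x≡0 : ∀ x → x + - 1ℚ * x ≡ 0ℚ
  x-x≡0 = solve-∀ ℚ-ring
∑-alternating (inside ∷ F)  (outside ∷ B) =
  trans (∑-split _) (trans (cong₂ _+_ (∑-when-0 (_⊆ᵇ B)) ∑-0) (ℚ.+-identityʳ 0ℚ))
∑-alternating (inside ∷ F)  (inside ∷ B)  =
  trans (∑-split _) (trans (cong₂ _+_ (∑-when-0 (_⊆ᵇ B)) (∑-alternating F B)) (ℚ.+-identityˡ _))

-- For a one-sided inverse μ of the zeta function of a finite poset P of subsets,
-- the sums over lower intervals determine those over upper intervals (by induction along ⊂).
module Möbius {N : ℕ} (P : Subset N → Bool) (μ : Subset N → Subset N → ℚ)
  (sum-below : ∀ F B → T (P B) → ∑ (λ H → when (P H) (when (H ⊆ᵇ B) (μ F H))) ≡ when (F ≡ᵇ B) 1ℚ)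
  where

  sum-from : Subset N → Subset N → ℚ
  sum-from A H = ∑ (λ F → when (P F) (when (A ⊆ᵇ F) (μ F H)))

  sum-from-below : ∀ A B → T (P B) →
    ∑ (λ H → when (P H) (when (H ⊆ᵇ B) (sum-from A H))) ≡ when (A ⊆ᵇ B) 1ℚ
  sum-from-below A B PB = begin
    ∑ (λ H → when (P H) (when (H ⊆ᵇ B) (∑ (λ F → when (P F) (when (A ⊆ᵇ F) (μ F H))))))
      ≡⟨ ∑-cong (λ H → trans (cong (when (P H)) (when-∑ (H ⊆ᵇ B) _)) (when-∑ (P H) _)) ⟩
    ∑ (λ H → ∑ (λ F → when (P H) (when (H ⊆ᵇ B) (when (P F) (when (A ⊆ᵇ F) (μ F H))))))
      ≡⟨ ∑-swap _ ⟩
    ∑ (λ F → ∑ (λ H → when (P H) (when (H ⊆ᵇ B) (when (P F) (when (A ⊆ᵇ F) (μ F H))))))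
      ≡⟨ ∑-cong (λ F → ∑-cong (λ H → trans (when-rotate (P H) (H ⊆ᵇ B) (P F) _)
                                            (cong (when (P F)) (when-rotate (P H) (H ⊆ᵇ B) (A ⊆ᵇ F) _)))) ⟩
    ∑ (λ F → ∑ (λ H → when (P F) (when (A ⊆ᵇ F) (when (P H) (when (H ⊆ᵇ B) (μ F H))))))
      ≡⟨ ∑-cong (λ F → sym (trans (cong (when (P F)) (when-∑ (A ⊆ᵇ F) _)) (when-∑ (P F) _))) ⟩
    ∑ (λ F → when (P F) (when (A ⊆ᵇ F) (∑ (λ H → when (P H) (when (H ⊆ᵇ B) (μ F H))))))
      ≡⟨ ∑-cong (λ F → cong (when (P F)) (cong (when (A ⊆ᵇ F)) (sum-below F B PB))) ⟩
    ∑ (λ F → when (P F) (when (A ⊆ᵇ F) (when (F ≡ᵇ B) 1ℚ)))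
      ≡⟨ ∑-cong (λ F → when-rotate (P F) (A ⊆ᵇ F) (F ≡ᵇ B) 1ℚ) ⟩
    ∑ (λ F → when (F ≡ᵇ B) (when (P F) (when (A ⊆ᵇ F) 1ℚ)))
      ≡⟨ ∑-[≡] B _ ⟩
    when (P B) (when (A ⊆ᵇ B) 1ℚ)
      ≡⟨ when-T _ PB ⟩
    when (A ⊆ᵇ B) 1ℚ ∎
    where open ≡-Reasoning

  sum-above : ∀ {A} → T (P A) → ∀ K → T (P K) → sum-from A K ≡ when (K ≡ᵇ A) 1ℚ
  sum-above {A} PA K = go K (⊂-wellFounded K)
    where
    go : ∀ K → Acc _⊂_ K → T (P K) → sum-from A K ≡ when (K ≡ᵇ A) 1ℚ
    go K (acc smaller) PK = begin
      sum-from A K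
        ≡⟨ ∙-cancelˡ (when (A ⊂ᵇ K) 1ℚ) (sum-from A K) (when (A ≡ᵇ K) 1ℚ) balance ⟩
      when (A ≡ᵇ K) 1ℚ
        ≡⟨ cong (λ b → when b 1ℚ) (≡ᵇ-sym A K) ⟩
      when (K ≡ᵇ A) 1ℚ ∎
      where
      open ≡-Reasoning
      proper : ∀ H → when (P H) (when (H ⊂ᵇ K) (sum-from A H)) ≡ when (H ≡ᵇ A) (when (P H) (when (H ⊂ᵇ K) 1ℚ))
      proper H = trans (when-cong (P H) λ PH → when-cong (H ⊂ᵇ K) λ H⊂K → go H (smaller (from-does (H ⊂? K) H⊂K)) PH)
                       (when-rotate (P H) (H ⊂ᵇ K) (H ≡ᵇ A) 1ℚ)
      balance : when (A ⊂ᵇ K) 1ℚ + sum-from A K ≡ when (A ⊂ᵇ K) 1ℚ + when (A ≡ᵇ K) 1ℚ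
      balance = begin
        when (A ⊂ᵇ K) 1ℚ + sum-from A K
          ≡⟨ cong₂ _+_ (sym (trans (∑-cong proper) (trans (∑-[≡] A _) (when-T _ PA))))
                       (sym (trans (∑-cong (λ H → when-comm (P H) (H ≡ᵇ K) _)) (trans (∑-[≡] K _) (when-T _ PK)))) ⟩
        ∑ (λ H → when (P H) (when (H ⊂ᵇ K) (sum-from A H))) + ∑ (λ H → when (P H) (when (H ≡ᵇ K) (sum-from A H)))
          ≡⟨ sym (∑-+ _ _) ⟩
        ∑ (λ H → when (P H) (when (H ⊂ᵇ K) (sum-from A H)) + when (P H) (when (H ≡ᵇ K) (sum-from A H)))
          ≡⟨ ∑-cong (λ H → sym (trans (cong (when (P H)) (when-⊆ᵇ-split H K _)) (when-+ (P H) _ _))) ⟩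
        ∑ (λ H → when (P H) (when (H ⊆ᵇ K) (sum-from A H)))
          ≡⟨ sum-from-below A K PK ⟩
        when (A ⊆ᵇ K) 1ℚ
          ≡⟨ when-⊆ᵇ-split A K 1ℚ ⟩
        when (A ⊂ᵇ K) 1ℚ + when (A ≡ᵇ K) 1ℚ ∎

∸-∸-cancelʳ : ∀ a {b c} → c ≤ b → (a ∸ c) ∸ (b ∸ c) ≡ a ∸ b
∸-∸-cancelʳ a {b} {c} c≤b = trans (ℕ.∸-+-assoc a c (b ∸ c)) (cong (a ∸_) (ℕ.m+[n∸m]≡n c≤b))

∪-lub : ∀ {N} {p q r : Subset N} → p ⊆ r → q ⊆ r → p ∪ q ⊆ r
∪-lub {p = p} {q} p⊆r q⊆r x∈p∪q = [ p⊆r , q⊆r ]′ (x∈p∪q⁻ p q x∈p∪q)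

⁅⁆-⊆ : ∀ {N} {x : Fin N} {p : Subset N} → x ∈ p → ⁅ x ⁆ ⊆ p
⁅⁆-⊆ {x = x} {p} x∈p y∈⁅x⁆ = subst (_∈ p) (sym (x∈⁅y⁆⇒x≡y x y∈⁅x⁆)) x∈p

module _ {N : ℕ} (M : Matroid N) where

  _spans_ : Subset N → Fin N → Set
  S spans e = rk M (S ∪ ⁅ e ⁆) ≤ rk M S

  spans-mono : ∀ {S U e} → S ⊆ U → S spans e → U spans e
  spans-mono {S} {U} {e} S⊆U S-spans = ℕ.+-cancelʳ-≤ (rk M S) (rk M (U ∪ ⁅ e ⁆)) (rk M U) (begin
    rk M (U ∪ ⁅ e ⁆) +ℕ rk M S                      ≤⟨ ℕ.+-mono-≤ (rk-mono M U∪e⊆) (rk-mono M S⊆) ⟩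
    rk M (U ∪ (S ∪ ⁅ e ⁆)) +ℕ rk M (U ∩ (S ∪ ⁅ e ⁆)) ≤⟨ rk-submod M U (S ∪ ⁅ e ⁆) ⟩
    rk M U +ℕ rk M (S ∪ ⁅ e ⁆)                      ≤⟨ ℕ.+-monoʳ-≤ (rk M U) S-spans ⟩
    rk M U +ℕ rk M S                                ∎)
    where
    open ℕ.≤-Reasoning
    U∪e⊆ : U ∪ ⁅ e ⁆ ⊆ U ∪ (S ∪ ⁅ e ⁆)
    U∪e⊆ = ∪-lub (p⊆p∪q _) (⊆-trans (q⊆p∪q S ⁅ e ⁆) (q⊆p∪q U _))
    S⊆ : S ⊆ U ∩ (S ∪ ⁅ e ⁆)
    S⊆ x∈S = x∈p∩q⁺ (S⊆U x∈S , p⊆p∪q _ x∈S)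

  spanned-∈-flat : ∀ {S H e} → IsFlat M H → S ⊆ H → S spans e → e ∈ H
  spanned-∈-flat {S} {H} {e} H-flat S⊆H S-spans with e ∈? H
  ... | yes e∈H = e∈H
  ... | no  e∉H = contradiction (spans-mono S⊆H S-spans) (ℕ.<⇒≱ (H-flat e e∉H))

  same-rank-spans : ∀ {S H e} → S ⊆ H → rk M H ≡ rk M S → e ∈ H → S spans e
  same-rank-spans S⊆H rkH≡rkS e∈H = ℕ.≤-trans (rk-mono M (∪-lub S⊆H (⁅⁆-⊆ e∈H))) (ℕ.≤-reflexive rkH≡rkS)

  same-rank-⊆-flat : ∀ {S H B} → IsFlat M B → S ⊆ B → S ⊆ H → rk M H ≡ rk M S → H ⊆ B
  same-rank-⊆-flat B-flat S⊆B S⊆H rkH≡rkS e∈H = spanned-∈-flat B-flat S⊆B (same-rank-spans S⊆H rkH≡rkS e∈H)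

  ∃-closure : ∀ S → ∃[ H ] IsFlat M H × S ⊆ H × rk M H ≡ rk M S
  ∃-closure S = go S (⊃-wellFounded S)
    where
    go : ∀ S → Acc _⊃_ S → ∃[ H ] IsFlat M H × S ⊆ H × rk M H ≡ rk M S
    go S (acc larger) with any? (λ e → ¬? (e ∈? S) ×-dec (rk M (S ∪ ⁅ e ⁆) ℕ.≤? rk M S))
    ... | yes (e , e∉S , S-spans) =
      let S⊆S∪e = p⊆p∪q ⁅ e ⁆
          H , H-flat , S∪e⊆H , rkH = go (S ∪ ⁅ e ⁆) (larger (S⊆S∪e , e , q⊆p∪q S ⁅ e ⁆ (x∈⁅x⁆ e) , e∉S))
      in H , H-flat , S∪e⊆H ∘ S⊆S∪e , trans rkH (ℕ.≤-antisym S-spans (rk-mono M S⊆S∪e))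
    ... | no nothing-spanned = S , S-flat , id , refl
      where
      S-flat : IsFlat M S
      S-flat e e∉S = ℕ.≰⇒> (λ S-spans → nothing-spanned (e , e∉S , S-spans))

  isFlatᵇ⇒IsFlat : ∀ {F} → T (isFlatᵇ M F) → IsFlat M F
  isFlatᵇ⇒IsFlat {F} F-flat e e∉F with e ∈? F | All.lookup (all⁺ _ (allFin N) F-flat) (∈-allFin e)
  ... | yes e∈F | _ = contradiction e∈F e∉F
  ... | no  _   | grows = ℕ.<ᵇ⇒< _ _ grows

  IsFlat⇒isFlatᵇ : ∀ {F} → IsFlat M F → T (isFlatᵇ M F)
  IsFlat⇒isFlatᵇ {F} F-flat = all⁻ _ {xs = allFin N} (All.tabulate (λ {e} _ → grows e))
    where
    grows : ∀ e → T (does (e ∈? F) ∨ (rk M F <ᵇ rk M (F ∪ ⁅ e ⁆)))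
    grows e with e ∈? F
    ... | yes _   = _
    ... | no  e∉F = ℕ.<⇒<ᵇ (F-flat e e∉F)

  sameRankᵇ : Subset N → Subset N → Bool
  sameRankᵇ S H = does (rk M S ℕ.≟ rk M H)

  ∑-closure-unique : ∀ {B} → IsFlat M B → ∀ S x →
    ∑ (λ H → when (isFlatᵇ M H) (when (H ⊆ᵇ B) (when (S ⊆ᵇ H) (when (sameRankᵇ S H) x)))) ≡ when (S ⊆ᵇ B) x
  ∑-closure-unique {B} B-flat S x = trans (∑-cong (λ H → sym (nested H))) (∑-closes (S ⊆? B))
    where
    closes : Subset N → Bool
    closes H = isFlatᵇ M H ∧ ((H ⊆ᵇ B) ∧ ((S ⊆ᵇ H) ∧ sameRankᵇ S H))
    nested : ∀ H → when (closes H) x ≡ when (isFlatᵇ M H) (when (H ⊆ᵇ B) (when (S ⊆ᵇ H) (when (sameRankᵇ S H) x)))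
    nested H = trans (when-∧ (isFlatᵇ M H) _ x) (cong (when (isFlatᵇ M H))
                 (trans (when-∧ (H ⊆ᵇ B) _ x) (cong (when (H ⊆ᵇ B)) (when-∧ (S ⊆ᵇ H) _ x))))
    closes⁻ : ∀ {H} → T (closes H) → IsFlat M H × H ⊆ B × S ⊆ H × rk M H ≡ rk M S
    closes⁻ {H} c with T-∧⁻ c
    ... | flat , c′ with T-∧⁻ c′
    ... | H⊆B , c″ with T-∧⁻ c″
    ... | S⊆H , same = isFlatᵇ⇒IsFlat flat , from-does (H ⊆? B) H⊆B , from-does (S ⊆? H) S⊆H
                     , sym (from-does (rk M S ℕ.≟ rk M H) same)
    ∑-closes : (d : Dec (S ⊆ B)) → ∑ (λ H → when (closes H) x) ≡ when (does d) x
    ∑-closes (yes S⊆B) with ∃-closure S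
    ... | H₀ , H₀-flat , S⊆H₀ , rkH₀ = ∑-point closes H₀ (λ _ → x) only-H₀ closes-H₀
      where
      H₀⊆B = same-rank-⊆-flat B-flat S⊆B S⊆H₀ rkH₀
      closes-H₀ : T (closes H₀)
      closes-H₀ = T-∧⁺ (IsFlat⇒isFlatᵇ H₀-flat) (T-∧⁺ (to-does (H₀ ⊆? B) H₀⊆B)
                    (T-∧⁺ (to-does (S ⊆? H₀) S⊆H₀) (to-does (rk M S ℕ.≟ rk M H₀) (sym rkH₀))))
      only-H₀ : ∀ H → T (closes H) → H ≡ H₀
      only-H₀ H c with closes⁻ c
      ... | H-flat , _ , S⊆H , rkH = ⊆-antisym (same-rank-⊆-flat H₀-flat S⊆H₀ S⊆H rkH)
                                              (same-rank-⊆-flat H-flat S⊆H S⊆H₀ rkH₀)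
    ∑-closes (no S⊈B) = trans (∑-cong (λ H → when-¬T x (S⊈B ∘ through H))) ∑-0
      where
      through : ∀ H → T (closes H) → S ⊆ B
      through H c = let _ , H⊆B , S⊆H , _ = closes⁻ c in ⊆-trans S⊆H H⊆B

  ∑-by-closure : ∀ {B} → IsFlat M B → (g : Subset N → ℚ) →
    ∑ (λ S → when (S ⊆ᵇ B) (g S))
      ≡ ∑ (λ H → when (isFlatᵇ M H) (when (H ⊆ᵇ B) (∑ (λ S → when (S ⊆ᵇ H) (when (sameRankᵇ S H) (g S))))))
  ∑-by-closure {B} B-flat g = sym (begin
    ∑ (λ H → when (isFlatᵇ M H) (when (H ⊆ᵇ B) (∑ (λ S → when (S ⊆ᵇ H) (when (sameRankᵇ S H) (g S))))))
      ≡⟨ ∑-cong (λ H → trans (cong (when (isFlatᵇ M H)) (when-∑ (H ⊆ᵇ B) _)) (when-∑ (isFlatᵇ M H) _)) ⟩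
    ∑ (λ H → ∑ (λ S → when (isFlatᵇ M H) (when (H ⊆ᵇ B) (when (S ⊆ᵇ H) (when (sameRankᵇ S H) (g S))))))
      ≡⟨ ∑-swap _ ⟩
    ∑ (λ S → ∑ (λ H → when (isFlatᵇ M H) (when (H ⊆ᵇ B) (when (S ⊆ᵇ H) (when (sameRankᵇ S H) (g S))))))
      ≡⟨ ∑-cong (λ S → ∑-closure-unique B-flat S (g S)) ⟩
    ∑ (λ S → when (S ⊆ᵇ B) (g S)) ∎)
    where open ≡-Reasoning

  -- A signed count of the sets F ⊆ S ⊆ H that span H; by μ-sum-below it is the
  -- Möbius function of the lattice of flats.
  μ : Subset N → Subset N → ℚ
  μ F H = ∑ (λ S → when (S ⊆ᵇ H) (when (sameRankᵇ S H) (when (F ⊆ᵇ S) (sign (S ─ F)))))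

  μ-sum-below : ∀ F B → T (isFlatᵇ M B) →
    ∑ (λ H → when (isFlatᵇ M H) (when (H ⊆ᵇ B) (μ F H))) ≡ when (F ≡ᵇ B) 1ℚ
  μ-sum-below F B B-flat = trans (sym (∑-by-closure (isFlatᵇ⇒IsFlat B-flat) _)) (∑-alternating F B)

  μ-vanishes : ∀ {F H} → ¬ (F ⊆ H) → μ F H ≡ 0ℚ
  μ-vanishes {F} {H} F⊈H = trans (∑-cong term-0) ∑-0
    where
    term-0 : ∀ S → when (S ⊆ᵇ H) (when (sameRankᵇ S H) (when (F ⊆ᵇ S) (sign (S ─ F)))) ≡ 0ℚ
    term-0 S with S ⊆? H | F ⊆? S
    ... | yes S⊆H | yes F⊆S = ⊥-elim (F⊈H (⊆-trans F⊆S S⊆H))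
    ... | yes _   | no _    = when-0 (sameRankᵇ S H)
    ... | no _    | _       = refl

  χMinor-as-interval-sum : ∀ {F F₂} (q : ℚ) → F ⊆ F₂ →
    χMinor M F F₂ q ≡ ∑ (λ S → when (S ⊆ᵇ F₂) (when (F ⊆ᵇ S) (sign (S ─ F) * q ^ (rk M F₂ ∸ rk M S))))
  χMinor-as-interval-sum {F} {F₂} q F⊆F₂ = begin
    χMinor M F F₂ q
      ≡⟨ sumWhere-allSubsets (λ S → S ⊆ᵇ F₂ ─ F)
                             (λ S → sign S * q ^ (minorRank M F (F₂ ─ F) ∸ minorRank M F S)) ⟩
    ∑ (λ S → when (S ⊆ᵇ F₂ ─ F) (sign S * q ^ (minorRank M F (F₂ ─ F) ∸ minorRank M F S)))
      ≡⟨ ∑-⊆─-reindex F F₂ F⊆ᵇF₂ _ ⟩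
    ∑ (λ S → when (S ⊆ᵇ F₂) (when (F ⊆ᵇ S)
               (sign (S ─ F) * q ^ (minorRank M F (F₂ ─ F) ∸ minorRank M F (S ─ F)))))
      ≡⟨ ∑-cong (λ S → when-cong (S ⊆ᵇ F₂) λ _ → when-cong (F ⊆ᵇ S) λ F⊆S →
                  cong (λ k → sign (S ─ F) * q ^ k) (exponent S F⊆S)) ⟩
    ∑ (λ S → when (S ⊆ᵇ F₂) (when (F ⊆ᵇ S) (sign (S ─ F) * q ^ (rk M F₂ ∸ rk M S)))) ∎
    where
    open ≡-Reasoning
    F⊆ᵇF₂ = to-does (F ⊆? F₂) F⊆F₂
    exponent : ∀ S → T (F ⊆ᵇ S) → minorRank M F (F₂ ─ F) ∸ minorRank M F (S ─ F) ≡ rk M F₂ ∸ rk M S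
    exponent S F⊆S = trans (cong₂ (λ X Y → (rk M X ∸ rk M F) ∸ (rk M Y ∸ rk M F))
                                  (─-∪-cancel F₂ F F⊆ᵇF₂) (─-∪-cancel S F F⊆S))
                         (∸-∸-cancelʳ (rk M F₂) (rk-mono M (from-does (F ⊆? S) F⊆S)))

  χMinor-self : ∀ {F} (q : ℚ) → χMinor M F F q ≡ 1ℚ
  χMinor-self {F} q = begin
    χMinor M F F q
      ≡⟨ χMinor-as-interval-sum q id ⟩
    ∑ (λ S → when (S ⊆ᵇ F) (when (F ⊆ᵇ S) (sign (S ─ F) * q ^ (rk M F ∸ rk M S))))
      ≡⟨ ∑-cong (λ S → sym (when-∧ (S ⊆ᵇ F) (F ⊆ᵇ S) _)) ⟩
    ∑ (λ S → when ((S ⊆ᵇ F) ∧ (F ⊆ᵇ S)) (sign (S ─ F) * q ^ (rk M F ∸ rk M S)))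
      ≡⟨ ∑-point (λ S → (S ⊆ᵇ F) ∧ (F ⊆ᵇ S)) F _ only-F (T-∧⁺ (to-does (F ⊆? F) id) (to-does (F ⊆? F) id)) ⟩
    sign (F ─ F) * q ^ (rk M F ∸ rk M F)
      ≡⟨ cong₂ (λ s k → s * q ^ k) (sign-─-self F) (ℕ.n∸n≡0 (rk M F)) ⟩
    1ℚ * 1ℚ
      ≡⟨ ℚ.*-identityˡ 1ℚ ⟩
    1ℚ ∎
    where
    open ≡-Reasoning
    only-F : ∀ S → T ((S ⊆ᵇ F) ∧ (F ⊆ᵇ S)) → S ≡ F
    only-F S both with T-∧⁻ {S ⊆ᵇ F} both
    ... | S⊆F , F⊆S = ⊆-antisym (from-does (S ⊆? F) S⊆F) (from-does (F ⊆? S) F⊆S)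

  χMinor-via-μ : ∀ {F F₂} (q : ℚ) → IsFlat M F₂ → F ⊆ F₂ →
    χMinor M F F₂ q ≡ ∑ (λ H → when (isFlatᵇ M H) (when (H ⊆ᵇ F₂) (μ F H * q ^ (rk M F₂ ∸ rk M H))))
  χMinor-via-μ {F} {F₂} q F₂-flat F⊆F₂ =
    trans (χMinor-as-interval-sum q F⊆F₂)
   (trans (∑-by-closure F₂-flat _)
          (∑-cong (λ H → cong (when (isFlatᵇ M H)) (cong (when (H ⊆ᵇ F₂)) (factor H)))))
    where
    q^corank : Subset N → ℚ
    q^corank S = q ^ (rk M F₂ ∸ rk M S)
    factor : ∀ H → ∑ (λ S → when (S ⊆ᵇ H) (when (sameRankᵇ S H) (when (F ⊆ᵇ S) (sign (S ─ F) * q^corank S))))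
                     ≡ μ F H * q^corank H
    factor H = trans (∑-cong (λ S → when-cong (S ⊆ᵇ H) λ _ → when-cong (sameRankᵇ S H) λ same →
                       trans (cong (λ k → when (F ⊆ᵇ S) (sign (S ─ F) * q ^ (rk M F₂ ∸ k)))
                                   (from-does (rk M S ℕ.≟ rk M H) same))
                             (sym (when-*ʳ (F ⊆ᵇ S) (sign (S ─ F)) (q^corank H)))))
              (trans (∑-cong (λ S → sym (trans (when-*ʳ (S ⊆ᵇ H) _ (q^corank H))
                                               (cong (when (S ⊆ᵇ H)) (when-*ʳ (sameRankᵇ S H) _ (q^corank H))))))
                     (∑-*ʳ (q^corank H) _))

  ∑-χMinor-over-flats : ∀ {F₁ F₂} (q : ℚ) → IsFlat M F₁ → IsFlat M F₂ → F₁ ⊆ F₂ →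
    ∑ (λ F → when (isFlatᵇ M F ∧ ((F₁ ⊆ᵇ F) ∧ (F ⊆ᵇ F₂))) (χMinor M F F₂ q)) ≡ q ^ (rk M F₂ ∸ rk M F₁)
  ∑-χMinor-over-flats {F₁} {F₂} q F₁-flat F₂-flat F₁⊆F₂ = begin
    ∑ (λ F → when (between F) (χMinor M F F₂ q))
      ≡⟨ ∑-cong (λ F → when-cong (between F) λ F-between →
           trans (χMinor-via-μ q F₂-flat (upper F-between))
                 (∑-cong (λ H → sym (when-∧ (isFlatᵇ M H) (H ⊆ᵇ F₂) _)))) ⟩
    ∑ (λ F → when (between F) (∑ (λ H → when (below H) (μ F H * q^corank H))))
      ≡⟨ ∑-when-swap between below _ ⟩
    ∑ (λ H → when (below H) (∑ (λ F → when (between F) (μ F H * q^corank H))))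
      ≡⟨ ∑-cong (λ H → when-cong (below H) (inverse H)) ⟩
    ∑ (λ H → when (below H) (when (H ≡ᵇ F₁) 1ℚ * q^corank H))
      ≡⟨ ∑-cong (λ H → trans (cong (when (below H)) (when-*ʳ (H ≡ᵇ F₁) 1ℚ (q^corank H)))
                             (when-comm (below H) (H ≡ᵇ F₁) _)) ⟩
    ∑ (λ H → when (H ≡ᵇ F₁) (when (below H) (1ℚ * q^corank H)))
      ≡⟨ ∑-[≡] F₁ _ ⟩
    when (below F₁) (1ℚ * q^corank F₁)
      ≡⟨ when-T _ (T-∧⁺ (IsFlat⇒isFlatᵇ F₁-flat) (to-does (F₁ ⊆? F₂) F₁⊆F₂)) ⟩
    1ℚ * q^corank F₁
      ≡⟨ ℚ.*-identityˡ _ ⟩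
    q ^ (rk M F₂ ∸ rk M F₁) ∎
    where
    open ≡-Reasoning
    open Möbius (isFlatᵇ M) μ μ-sum-below using (sum-above)
    between below : Subset N → Bool
    between F = isFlatᵇ M F ∧ ((F₁ ⊆ᵇ F) ∧ (F ⊆ᵇ F₂))
    below H = isFlatᵇ M H ∧ (H ⊆ᵇ F₂)
    q^corank : Subset N → ℚ
    q^corank H = q ^ (rk M F₂ ∸ rk M H)
    upper : ∀ {F} → T (between F) → F ⊆ F₂
    upper {F} F-between = from-does (F ⊆? F₂) (proj₂ (T-∧⁻ {F₁ ⊆ᵇ F} (proj₂ (T-∧⁻ {isFlatᵇ M F} F-between))))
    μ-below : ∀ {F H} → H ⊆ F₂ → when (F ⊆ᵇ F₂) (μ F H) ≡ μ F H
    μ-below {F} {H} H⊆F₂ with F ⊆? F₂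
    ... | yes _     = refl
    ... | no  F⊈F₂  = sym (μ-vanishes (λ F⊆H → F⊈F₂ (⊆-trans F⊆H H⊆F₂)))
    inverse : ∀ H → T (below H) → ∑ (λ F → when (between F) (μ F H * q^corank H)) ≡ when (H ≡ᵇ F₁) 1ℚ * q^corank H
    inverse H H-below = begin
      ∑ (λ F → when (between F) (μ F H * q^corank H))
        ≡⟨ trans (∑-cong (λ F → sym (when-*ʳ (between F) (μ F H) (q^corank H)))) (∑-*ʳ (q^corank H) _) ⟩
      ∑ (λ F → when (between F) (μ F H)) * q^corank H
        ≡⟨ cong (_* q^corank H) (∑-cong λ F → trans (when-∧ (isFlatᵇ M F) _ _) (cong (when (isFlatᵇ M F))
             (trans (when-∧ (F₁ ⊆ᵇ F) _ _) (cong (when (F₁ ⊆ᵇ F)) (μ-below H⊆F₂))))) ⟩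
      ∑ (λ F → when (isFlatᵇ M F) (when (F₁ ⊆ᵇ F) (μ F H))) * q^corank H
        ≡⟨ cong (_* q^corank H) (sum-above (IsFlat⇒isFlatᵇ F₁-flat) H H-flat) ⟩
      when (H ≡ᵇ F₁) 1ℚ * q^corank H ∎
      where
      H-flat = proj₁ (T-∧⁻ {isFlatᵇ M H} H-below)
      H⊆F₂ = from-does (H ⊆? F₂) (proj₂ (T-∧⁻ {isFlatᵇ M H} H-below))

  ∑-χMinor-over-proper-flats : ∀ {F₁ F₂} (q : ℚ) → IsFlat M F₁ → IsFlat M F₂ → F₁ ⊆ F₂ →
    ∑ (λ F → when (isFlatᵇ M F ∧ ((F₁ ⊆ᵇ F) ∧ (F ⊂ᵇ F₂))) (χMinor M F F₂ q))
      ≡ q ^ (rk M F₂ ∸ rk M F₁) - 1ℚ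
  ∑-χMinor-over-proper-flats {F₁} {F₂} q F₁-flat F₂-flat F₁⊆F₂ =
    trans (x≡[x+1]-1 _) (cong (_- 1ℚ) (begin
      ∑ (λ F → when (proper F) (χMinor M F F₂ q)) + 1ℚ
        ≡⟨ cong (∑ (λ F → when (proper F) (χMinor M F F₂ q)) +_) (sym top) ⟩
      ∑ (λ F → when (proper F) (χMinor M F F₂ q)) + ∑ (λ F → when (is-top F) (χMinor M F F₂ q))
        ≡⟨ sym (∑-+ _ _) ⟩
      ∑ (λ F → when (proper F) (χMinor M F F₂ q) + when (is-top F) (χMinor M F F₂ q))
        ≡⟨ ∑-cong (λ F → sym (when-∧-split (isFlatᵇ M F)
                               (when-∧-split (F₁ ⊆ᵇ F) (when-⊆ᵇ-split F F₂)) _)) ⟩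
      ∑ (λ F → when (isFlatᵇ M F ∧ ((F₁ ⊆ᵇ F) ∧ (F ⊆ᵇ F₂))) (χMinor M F F₂ q))
        ≡⟨ ∑-χMinor-over-flats q F₁-flat F₂-flat F₁⊆F₂ ⟩
      q ^ (rk M F₂ ∸ rk M F₁) ∎))
    where
    open ≡-Reasoning
    proper is-top : Subset N → Bool
    proper F = isFlatᵇ M F ∧ ((F₁ ⊆ᵇ F) ∧ (F ⊂ᵇ F₂))
    is-top F = isFlatᵇ M F ∧ ((F₁ ⊆ᵇ F) ∧ (F ≡ᵇ F₂))
    x≡[x+1]-1 : ∀ x → x ≡ (x + 1ℚ) - 1ℚ
    x≡[x+1]-1 = solve-∀ ℚ-ring
    only-F₂ : ∀ F → T (is-top F) → F ≡ F₂
    only-F₂ F F-top = from-does (F ≟ˢ F₂) (proj₂ (T-∧⁻ {F₁ ⊆ᵇ F} (proj₂ (T-∧⁻ {isFlatᵇ M F} F-top))))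
    F₂-top : T (is-top F₂)
    F₂-top = T-∧⁺ (IsFlat⇒isFlatᵇ F₂-flat) (T-∧⁺ (to-does (F₁ ⊆? F₂) F₁⊆F₂) (to-does (F₂ ≟ˢ F₂) refl))
    top : ∑ (λ F → when (is-top F) (χMinor M F F₂ q)) ≡ 1ℚ
    top = trans (∑-point is-top F₂ _ only-F₂ F₂-top) (χMinor-self q)

geometric-sum : ∀ k q → qInt k q * (q - 1ℚ) ≡ q ^ k - 1ℚ
geometric-sum zero    q = trans (ℚ.*-zeroˡ (q - 1ℚ)) (sym (ℚ.+-inverseʳ 1ℚ))
geometric-sum (suc k) q = begin
  (qInt k q + q ^ k) * (q - 1ℚ)            ≡⟨ ℚ.*-distribʳ-+ (q - 1ℚ) (qInt k q) (q ^ k) ⟩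
  qInt k q * (q - 1ℚ) + q ^ k * (q - 1ℚ)   ≡⟨ cong (_+ q ^ k * (q - 1ℚ)) (geometric-sum k q) ⟩
  (q ^ k - 1ℚ) + q ^ k * (q - 1ℚ)          ≡⟨ telescope (q ^ k) q ⟩
  q * q ^ k - 1ℚ                            ∎
  where
  open ≡-Reasoning
  telescope : ∀ p q → (p - 1ℚ) + p * (q - 1ℚ) ≡ q * p - 1ℚ
  telescope = solve-∀ ℚ-ring

qInt-closed-form : ∀ k q .{{_ : NonZero (q - 1ℚ)}} → qInt k q ≡ (q ^ k - 1ℚ) * 1/ (q - 1ℚ)
qInt-closed-form k q = begin
  qInt k q                                   ≡⟨ sym (ℚ.*-identityʳ _) ⟩
  qInt k q * 1ℚ                              ≡⟨ cong (qInt k q *_) (sym (ℚ.*-inverseʳ (q - 1ℚ))) ⟩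
  qInt k q * ((q - 1ℚ) * 1/ (q - 1ℚ))        ≡⟨ sym (ℚ.*-assoc (qInt k q) (q - 1ℚ) (1/ (q - 1ℚ))) ⟩
  qInt k q * (q - 1ℚ) * 1/ (q - 1ℚ)          ≡⟨ cong (_* 1/ (q - 1ℚ)) (geometric-sum k q) ⟩
  (q ^ k - 1ℚ) * 1/ (q - 1ℚ)                 ∎
  where open ≡-Reasoning

proposition2p1 : ∀ {n : ℕ} (M : Matroid (suc n)) (F₁ F₂ : Subset (suc n))
    → IsFlat M F₁ → IsFlat M F₂ → F₁ ⊆ F₂
    → (q : ℚ) → .{{_ : NonZero (q - 1ℚ)}}
    → qInt (rk M F₂ ∸ rk M F₁) q ≡ sumFlatsBetween M F₁ F₂ q
proposition2p1 M F₁ F₂ F₁-flat F₂-flat F₁⊆F₂ q = begin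
  qInt (rk M F₂ ∸ rk M F₁) q
    ≡⟨ qInt-closed-form (rk M F₂ ∸ rk M F₁) q ⟩
  (q ^ (rk M F₂ ∸ rk M F₁) - 1ℚ) * 1/ (q - 1ℚ)
    ≡⟨ cong (_* 1/ (q - 1ℚ)) (∑-χMinor-over-proper-flats M q F₁-flat F₂-flat F₁⊆F₂) ⟨
  ∑ (λ F → when (proper F) (χMinor M F F₂ q)) * 1/ (q - 1ℚ)
    ≡⟨ ∑-*ʳ (1/ (q - 1ℚ)) _ ⟨
  ∑ (λ F → when (proper F) (χMinor M F F₂ q) * 1/ (q - 1ℚ))
    ≡⟨ ∑-cong (λ F → when-*ʳ (proper F) (χMinor M F F₂ q) (1/ (q - 1ℚ))) ⟩
  ∑ (λ F → when (proper F) (χ̄Minor M F F₂ q))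
    ≡⟨ sumWhere-allSubsets proper (λ F → χ̄Minor M F F₂ q) ⟨
  sumFlatsBetween M F₁ F₂ q ∎
  where
  open ≡-Reasoning
  proper : Subset _ → Bool
  proper F = isFlatᵇ M F ∧ ((F₁ ⊆ᵇ F) ∧ (F ⊂ᵇ F₂))
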